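{- Let $G$ be a mixed unit interval graph and let $\mathcal{B}=\langle B_{i,j}\rangle_{1\le j\le k,\,1\le i\le r_j}$ be a $\mathcal{U}$-bubble model for $G$. Then the size $\omega(G)$ of a maximum clique of $G$ equals $$\omega(G)=\max_{\substack{j\in\{1,\dots,k-1\}\\ i\in\{1,\dots,r_{j+1}\}}}\left(\sum_{i'=i+1}^{r_j}|B_{i',j}|+\sum_{i'=1}^{i-1}|B_{i',j+1}|+a_i\right),$$ where $a_i=\max\{|B_{i,j}|,\,|B_{i,j+1}|,\,|B^{*+}_{i,j}|+|B^{+*}_{i,j+1}|\}$ if $i\le r_j$, and $a_i=|B_{i,j+1}|$ otherwise (empty sums are $0$).
   Context: A mixed unit interval graph is the intersection graph of a family of unit-length intervals each of which may be closed, open, closed-open or open-closed. A 2-dimensional $\mathcal{U}$-bubble structure for a finite nonempty set $A$ is a family $\mathcal{B}=\langle B_{i,j}\rangle_{1\le j\le k,\,1\le i\le r_j}$ of pairwise disjoint (possibly empty) sets ("bubbles") with union $A$, where each bubble is partitioned into four (possibly empty) quadrants $B_{i,j}=B^{++}_{i,j}\cup B^{+- }_{i,j}\cup B^{ -+}_{i,j}\cup B^{ -- }_{i,j}$. Write $B^{*+}_{i,j}=B^{++}_{i,j}\cup B^{ -+}_{i,j}$ and $B^{+*}_{i,j}=B^{++}_{i,j}\cup B^{+- }_{i,j}$. Bubbles with the same $j$ form column $j$; bubbles with the same $i$ form row $i$. The graph $G(\mathcal{B})$ has vertex set $A$, and distinct $u,v$ are adjacent iff, for some ordering of $u,v$,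 $u\in B_{i,j}$, $v\in B_{i',j'}$ and one of: (a) $j=j'$; (b) $j=j'-1$ and $i>i'$; (c) $j=j'-1$, $i=i'$, $u\in B^{*+}_{i,j}$ and $v\in B^{+*}_{i',j'}$. A $\mathcal{U}$-bubble model of $G$ is such a structure for $V(G)$ with (i) $G\cong G(\mathcal{B})$; (ii) each column and each row contains a nonempty bubble; (iii) $B_{r_j,j}\neq\emptyset$ for every $j$; (iv) with $\mathrm{top}(j)=\min\{i:B_{i,j}\neq\emptyset\}$, $\mathrm{top}(1)=1$ and $\mathrm{top}(j)\le\mathrm{top}(j+1)$. -}

module Defs where

open import Data.Nat using (ℕ; zero; suc; _+_; _∸_; _≤_; _<_; _⊔_; _≡ᵇ_; _≤ᵇ_)
open import Data.Bool using (Bool; true; false; _∧_; if_then_else_)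
open import Data.Fin using (Fin)
open import Data.Fin.Permutation using (Permutation′; _⟨$⟩ʳ_)
open import Data.List using (List; length; filterᵇ; allFin; map; upTo; foldr)
open import Data.Nat.ListAction using (sum)
open import Data.List.Membership.Propositional using (_∈_)
open import Data.List.Relation.Unary.Unique.Propositional using (Unique)
open import Data.Product using (_×_; Σ; ∃; ∃-syntax)
open import Data.Sum using (_⊎_)
open import Relation.Nullary using (¬_)
open import Relation.Binary.PropositionalEquality using (_≡_)

Graph : ℕ → Set₁
Graph n = Fin n → Fin n → Set

IsClique : ∀ {n} → Graph n → List (Fin n) → Set
IsClique {n} G xs = Unique xs × (∀ (u v : Fin n) → u ∈ xs → v ∈ xs → ¬ (u ≡ v) → G u v)

CliqueNumber : ∀ {n} → Graph n → ℕ → Set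
CliqueNumber {n} G m =
  (∃[ xs ] (IsClique G xs × length xs ≡ m)) ×
  (∀ xs → IsClique G xs → length xs ≤ m)

_≅_ : ∀ {n} → Graph n → Graph n → Set
_≅_ {n} G H = Σ (Permutation′ n) λ π →
  ∀ u v → (G u v → H (π ⟨$⟩ʳ u) (π ⟨$⟩ʳ v)) × (H (π ⟨$⟩ʳ u) (π ⟨$⟩ʳ v) → G u v)

-- Vertex v lies in bubble B_{row v, col v}; its quadrant is
-- (sgn₁ v , sgn₂ v), true = '+', false = '-', so that
-- B^{*+} = {second sign +}, B^{+*} = {first sign +}.
record BubbleStructure (n : ℕ) : Set where
  field
    k    : ℕ
    r    : ℕ → ℕ
    col  : Fin n → ℕ
    row  : Fin n → ℕ
    sgn₁ : Fin n → Bool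
    sgn₂ : Fin n → Bool
    col-range : ∀ v → 1 ≤ col v × col v ≤ k
    row-range : ∀ v → 1 ≤ row v × row v ≤ r (col v)

module _ {n : ℕ} (B : BubbleStructure n) where
  open BubbleStructure B

  -- ordered adjacency condition for (u , v): (a), (b), (c)
  BRel : Fin n → Fin n → Set
  BRel u v =
    col u ≡ col v
    ⊎ (suc (col u) ≡ col v × row v < row u)
    ⊎ (suc (col u) ≡ col v × row u ≡ row v × sgn₂ u ≡ true × sgn₁ v ≡ true)

  GB : Graph n
  GB u v = ¬ (u ≡ v) × (BRel u v ⊎ BRel v u)

  count : (Fin n → Bool) → ℕ
  count p = length (filterᵇ p (allFin n))

  ∣B∣ : ℕ → ℕ → ℕ
  ∣B∣ i j = count (λ v → (row v ≡ᵇ i) ∧ (col v ≡ᵇ j))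

  ∣B*+∣ : ℕ → ℕ → ℕ
  ∣B*+∣ i j = count (λ v → (row v ≡ᵇ i) ∧ (col v ≡ᵇ j) ∧ sgn₂ v)

  ∣B+*∣ : ℕ → ℕ → ℕ
  ∣B+*∣ i j = count (λ v → (row v ≡ᵇ i) ∧ (col v ≡ᵇ j) ∧ sgn₁ v)

  -- U-bubble model conditions (ii)–(iv); (i) is stated separately.
  record IsUBubbleModel : Set where
    field
      col-nonempty : ∀ j → 1 ≤ j → j ≤ k → ∃[ v ] col v ≡ j
      row-nonempty : ∀ i j → 1 ≤ j → j ≤ k → 1 ≤ i → i ≤ r j → ∃[ v ] row v ≡ i
      last-nonempty : ∀ j → 1 ≤ j → j ≤ k → ∃[ v ] (col v ≡ j × row v ≡ r j)
      top-one : ∃[ v ] (col v ≡ 1 × row v ≡ 1)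
      -- top(j) ≤ top(j+1): every vertex of column j+1 has a vertex of
      -- column j in a row at most its own
      top-mono : ∀ j → 1 ≤ j → j < k → ∀ v → col v ≡ suc j →
                 ∃[ u ] (col u ≡ j × row u ≤ row v)

-- Σ_{i=a}^{b} f i  (0 if b < a)
sumFromTo : (ℕ → ℕ) → ℕ → ℕ → ℕ
sumFromTo f a b = sum (map (λ t → f (a + t)) (upTo (suc b ∸ a)))

-- max_{i=a}^{b} f i  (only used on nonempty ranges; values are in ℕ)
maxFromTo : (ℕ → ℕ) → ℕ → ℕ → ℕ
maxFromTo f a b = foldr _⊔_ 0 (map (λ t → f (a + t)) (upTo (suc b ∸ a)))

module _ {n : ℕ} (B : BubbleStructure n) where
  open BubbleStructure B

  aTerm : ℕ → ℕ → ℕ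
  aTerm j i = if i ≤ᵇ r j
              then (∣B∣ B i j ⊔ ∣B∣ B i (suc j)) ⊔ (∣B*+∣ B i j + ∣B+*∣ B i (suc j))
              else ∣B∣ B i (suc j)

  term : ℕ → ℕ → ℕ
  term j i = sumFromTo (λ i′ → ∣B∣ B i′ j) (suc i) (r j)
           + sumFromTo (λ i′ → ∣B∣ B i′ (suc j)) 1 (i ∸ 1)
           + aTerm j i

  omegaFormula : ℕ
  omegaFormula = maxFromTo (λ j → maxFromTo (λ i → term j i) 1 (r (suc j))) 1 (k ∸ 1)

module Submission where

-- Vertices two columns apart are never adjacent in G(B), so a clique lies in two consecutive
-- columns j, j+1. Let i be the largest row it meets in column j+1 (i = 1 if it misses that
-- column). Then the clique lies in the "window" made of column j below row i, column j+1
-- above row i, and a centre in row i: B_{i,j}, B_{i,j+1}, or, when the clique meets both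
-- bubbles, B^{*+}_{i,j} ∪ B^{+*}_{i,j+1}, because a vertex of B_{i,j} and one of B_{i,j+1}
-- are adjacent only through rule (c). Conversely every window is a clique, and its size is the
-- (j, i) term of the formula with a_i replaced by the size of its centre.

open import Defs hiding (count)
open import Data.Bool using (true; false; T)
open import Data.Bool.Properties using (T?; T-≡)
open import Data.Empty using (⊥; ⊥-elim)
open import Data.Fin using (Fin)
open import Data.Fin.Permutation using (_⟨$⟩ʳ_; _⟨$⟩ˡ_; inverseˡ; inverseʳ)
open import Data.Fin.Properties using () renaming (_≟_ to _≟ᶠ_)
open import Data.List using (List; []; _∷_; length; filter; filterᵇ; allFin; map; upTo)
open import Data.List.Extrema.Nat using (argmin; argmax; argmin-sel; argmax-sel; f[argmin]≤f[⊤]; f[argmin]≤f[xs]; f[⊥]≤f[argmax]; f[xs]≤f[argmax])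
open import Data.List.Membership.Propositional using (_∈_; find; lose)
open import Data.List.Membership.Propositional.Properties using (∉[]; ∈-filter⁺; ∈-filter⁻; ∈-allFin; ∈-map⁺; ∈-map⁻; ∈-upTo⁺; ∈-upTo⁻; foldr-selective)
open import Data.List.Properties using (foldr-preservesᵒ; filter-≐; filter-notAll; filter-none; map-applyUpTo; map-cong; length-map)
open import Data.List.Relation.Binary.Subset.Propositional using (_⊆_)
open import Data.List.Relation.Unary.All as All using ()
open import Data.List.Relation.Unary.AllPairs using (_∷_)
open import Data.List.Relation.Unary.Any as Any using (here; there; any?)
open import Data.List.Relation.Unary.Unique.Propositional using (Unique)
open import Data.List.Relation.Unary.Unique.Propositional.Properties using (map⁺; filter⁺; allFin⁺)
open import Data.Nat using (ℕ; zero; suc; _+_; _∸_; _≤_; _<_; _⊔_; _≤ᵇ_; z≤n; s≤s; z<s)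
open import Data.Nat.ListAction using (sum)
open import Data.Nat.Properties
open import Data.Product using (_×_; _,_; proj₁; proj₂; ∃-syntax)
open import Data.Sum using (_⊎_; inj₁; inj₂; [_,_])
open import Function using (_∘_; Equivalence)
open import Level using (Level; 0ℓ)
open import Relation.Binary.Definitions using (DecidableEquality)
open import Relation.Binary.PropositionalEquality using (_≡_; refl; sym; trans; cong; cong₂; subst; subst₂; module ≡-Reasoning)
open import Relation.Nullary using (¬_; does; yes; no; _×-dec_; _⊎-dec_; ¬?)
open import Relation.Unary using (Pred; Decidable; _≐_; _∪_)
open import Relation.Unary.Properties using (_∪?_)

private
  variable
    a ℓ ℓ′ : Level
    A : Set a

count : {P : Pred A ℓ} → Decidable P → List A → ℕ
count P? xs = length (filter P? xs)

filterᵇ-does : {P : Pred A ℓ} (P? : Decidable P) → ∀ xs → filterᵇ (does ∘ P?) xs ≡ filter P? xs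
filterᵇ-does P? [] = refl
filterᵇ-does P? (x ∷ xs) with does (P? x)
... | true = cong (x ∷_) (filterᵇ-does P? xs)
... | false = filterᵇ-does P? xs

count-∅ : {P : Pred A ℓ} (P? : Decidable P) → (∀ x → ¬ P x) → ∀ xs → count P? xs ≡ 0
count-∅ P? ∅ xs = cong length (filter-none P? {xs} (All.tabulate (λ {x} _ → ∅ x)))

module _ {P : Pred A ℓ} {Q : Pred A ℓ′} (P? : Decidable P) (Q? : Decidable Q) where

  count-≐ : P ≐ Q → ∀ xs → count P? xs ≡ count Q? xs
  count-≐ P≐Q xs = cong length (filter-≐ P? Q? P≐Q xs)

  count-∪ : (∀ {x} → P x → Q x → ⊥) → ∀ xs → count (P? ∪? Q?) xs ≡ count P? xs + count Q? xs
  count-∪ disjoint [] = refl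
  count-∪ disjoint (x ∷ xs) with P? x | Q? x
  ... | yes p | yes q = ⊥-elim (disjoint p q)
  ... | yes _ | no _ = cong suc (count-∪ disjoint xs)
  ... | no _ | yes _ = trans (cong suc (count-∪ disjoint xs)) (sym (+-suc _ _))
  ... | no _ | no _ = count-∪ disjoint xs

length-≤-unique : DecidableEquality A → {xs ys : List A} → Unique xs → xs ⊆ ys → length xs ≤ length ys
length-≤-unique _≟_ {[]} _ _ = z≤n
length-≤-unique _≟_ {x ∷ xs} {ys} (x∉xs ∷ unique) xs⊆ys = begin
  suc (length xs)                         ≤⟨ s≤s (length-≤-unique _≟_ unique xs⊆ys∖x) ⟩
  suc (length (filter (¬? ∘ (_≟ x)) ys))  ≤⟨ filter-notAll (¬? ∘ (_≟ x)) ys x∈ys ⟩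
  length ys                               ∎
  where
  open ≤-Reasoning
  x∈ys : Any.Any (λ y → ¬ ¬ y ≡ x) ys
  x∈ys = Any.map (λ x≡y y≢x → y≢x (sym x≡y)) (xs⊆ys (here refl))
  xs⊆ys∖x : xs ⊆ filter (¬? ∘ (_≟ x)) ys
  xs⊆ys∖x y∈xs = ∈-filter⁺ (¬? ∘ (_≟ x)) (xs⊆ys (there y∈xs)) (λ y≡x → All.lookup x∉xs y∈xs (sym y≡x))

sum-upTo-suc : ∀ (g : ℕ → ℕ) m → sum (map g (upTo (suc m))) ≡ g 0 + sum (map (g ∘ suc) (upTo m))
sum-upTo-suc g m = cong (λ ns → g 0 + sum ns) (trans (map-applyUpTo suc g m) (sym (map-applyUpTo (λ t → t) (g ∘ suc) m)))

InRange : ℕ → ℕ → Pred ℕ _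
InRange a m x = a ≤ x × x < a + m

inRange? : ∀ a m → Decidable (InRange a m)
inRange? a m x = a ≤? x ×-dec x <? a + m

InRange-suc : ∀ a m → InRange a (suc m) ≐ (_≡ a) ∪ InRange (suc a) m
InRange-suc a m = split , join
  where
  split : ∀ {x} → InRange a (suc m) x → x ≡ a ⊎ InRange (suc a) m x
  split {x} (a≤x , x<a+1+m) with m≤n⇒m<n∨m≡n a≤x
  ... | inj₁ a<x = inj₂ (a<x , subst (x <_) (+-suc a m) x<a+1+m)
  ... | inj₂ a≡x = inj₁ (sym a≡x)
  join : ∀ {x} → x ≡ a ⊎ InRange (suc a) m x → InRange a (suc m) x
  join (inj₁ refl) = ≤-refl , m<m+n a z<s
  join {x} (inj₂ (a<x , x<1+a+m)) = <⇒≤ a<x , subst (x <_) (sym (+-suc a m)) x<1+a+m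

module _ (key : A → ℕ) {Q : Pred A ℓ} (Q? : Decidable Q) where

  count-InRange : ∀ a m xs →
    count (λ x → Q? x ×-dec inRange? a m (key x)) xs ≡
    sum (map (λ t → count (λ x → key x ≟ a + t ×-dec Q? x) xs) (upTo m))
  count-InRange a zero xs = count-∅ _ (λ x (_ , a≤k , k<a+0) → <⇒≱ k<a+0 (subst (_≤ key x) (sym (+-identityʳ a)) a≤k)) xs
  count-InRange a (suc m) xs = begin
    count (λ x → Q? x ×-dec inRange? a (suc m) (key x)) xs
      ≡⟨ count-≐ _ _ (split , join) xs ⟩
    count ((λ x → key x ≟ a ×-dec Q? x) ∪? (λ x → Q? x ×-dec inRange? (suc a) m (key x))) xs
      ≡⟨ count-∪ _ _ (λ (k≡a , _) (_ , a<k , _) → <-irrefl (sym k≡a) a<k) xs ⟩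
    f a + count (λ x → Q? x ×-dec inRange? (suc a) m (key x)) xs
      ≡⟨ cong₂ _+_ (cong f (sym (+-identityʳ a))) (count-InRange (suc a) m xs) ⟩
    f (a + 0) + sum (map (λ t → f (suc a + t)) (upTo m))
      ≡⟨ cong (λ ns → f (a + 0) + sum ns) (map-cong (λ t → cong f (sym (+-suc a t))) (upTo m)) ⟩
    f (a + 0) + sum (map (λ t → f (a + suc t)) (upTo m))
      ≡⟨ sym (sum-upTo-suc (λ t → f (a + t)) m) ⟩
    sum (map (λ t → f (a + t)) (upTo (suc m)))
      ∎
    where
    open ≡-Reasoning
    f : ℕ → ℕ
    f s = count (λ x → key x ≟ s ×-dec Q? x) xs
    split : ∀ {x} → Q x × InRange a (suc m) (key x) → (key x ≡ a × Q x) ⊎ (Q x × InRange (suc a) m (key x))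
    split (q , r) with proj₁ (InRange-suc a m) r
    ... | inj₁ k≡a = inj₁ (k≡a , q)
    ... | inj₂ r′ = inj₂ (q , r′)
    join : ∀ {x} → (key x ≡ a × Q x) ⊎ (Q x × InRange (suc a) m (key x)) → Q x × InRange a (suc m) (key x)
    join (inj₁ (k≡a , q)) = q , proj₂ (InRange-suc a m) (inj₁ k≡a)
    join (inj₂ (q , r′)) = q , proj₂ (InRange-suc a m) (inj₂ r′)

module _ (f : A → ℕ) (x : A) (xs : List A) where

  argmin-∈ : argmin f x xs ∈ x ∷ xs
  argmin-∈ with argmin-sel f x xs
  ... | inj₁ ≡x = here ≡x
  ... | inj₂ ∈xs = there ∈xs

  argmin-≤ : ∀ {v} → v ∈ x ∷ xs → f (argmin f x xs) ≤ f v
  argmin-≤ (here refl) = f[argmin]≤f[⊤] {f = f} x xs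
  argmin-≤ (there v∈) = All.lookup (f[argmin]≤f[xs] {f = f} x xs) v∈

  argmax-∈ : argmax f x xs ∈ x ∷ xs
  argmax-∈ with argmax-sel f x xs
  ... | inj₁ ≡x = here ≡x
  ... | inj₂ ∈xs = there ∈xs

  ≤-argmax : ∀ {v} → v ∈ x ∷ xs → f v ≤ f (argmax f x xs)
  ≤-argmax (here refl) = f[⊥]≤f[argmax] {f = f} x xs
  ≤-argmax (there v∈) = All.lookup (f[xs]≤f[argmax] {f = f} x xs) v∈

module _ {P : Pred A ℓ} (P? : Decidable P) (f : A → ℕ) where

  argmax-satisfying : ∀ xs → (∀ {v} → v ∈ xs → ¬ P v) ⊎ ∃[ t ] (t ∈ xs × P t × (∀ {v} → v ∈ xs → P v → f v ≤ f t))
  argmax-satisfying xs with filter P? xs in filtered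
  ... | [] = inj₁ λ {v} v∈ pv → ∉[] (subst (v ∈_) filtered (∈-filter⁺ P? v∈ pv))
  ... | w ∷ ws = inj₂ (t , proj₁ t∈xs×Pt , proj₂ t∈xs×Pt ,
                       λ {v} v∈ pv → ≤-argmax f w ws (subst (v ∈_) filtered (∈-filter⁺ P? v∈ pv)))
    where
    t : A
    t = argmax f w ws
    t∈xs×Pt : t ∈ xs × P t
    t∈xs×Pt = ∈-filter⁻ P? (subst (t ∈_) (sym filtered) (argmax-∈ f w ws))

≤∧≤1+⇒≡∨≡1+ : ∀ {m n} → m ≤ n → n ≤ suc m → n ≡ m ⊎ n ≡ suc m
≤∧≤1+⇒≡∨≡1+ m≤n n≤1+m with m≤n⇒m<n∨m≡n n≤1+m
... | inj₁ n<1+m = inj₁ (≤-antisym (≤-pred n<1+m) m≤n)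
... | inj₂ n≡1+m = inj₂ n≡1+m

values : (ℕ → ℕ) → ℕ → ℕ → List ℕ
values f a b = map (λ t → f (a + t)) (upTo (suc b ∸ a))

module _ (f : ℕ → ℕ) (a b : ℕ) where

  ∈-values⁺ : ∀ {x} → a ≤ x → x ≤ b → f x ∈ values f a b
  ∈-values⁺ a≤x x≤b =
    subst (_∈ values f a b) (cong f (m+[n∸m]≡n a≤x)) (∈-map⁺ (λ t → f (a + t)) (∈-upTo⁺ (∸-monoˡ-< (s≤s x≤b) a≤x)))

  ∈-values⁻ : a ≤ b → ∀ {y} → y ∈ values f a b → ∃[ x ] (a ≤ x × x ≤ b × y ≡ f x)
  ∈-values⁻ a≤b y∈ with ∈-map⁻ (λ t → f (a + t)) y∈
  ... | t , t∈ , refl =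
    a + t , m≤m+n a t , ≤-pred (subst (a + t <_) (m+[n∸m]≡n (m≤n⇒m≤1+n a≤b)) (+-monoʳ-< a (∈-upTo⁻ t∈))) , refl

  ≤-maxFromTo : ∀ {x} → a ≤ x → x ≤ b → f x ≤ maxFromTo f a b
  ≤-maxFromTo a≤x x≤b =
    foldr-preservesᵒ (λ m n → [ m≤n⇒m≤n⊔o n , m≤n⇒m≤o⊔n m ]) 0 (values f a b) (inj₂ (Any.map ≤-reflexive (∈-values⁺ a≤x x≤b)))

  maxFromTo-attained : a ≤ b → ∃[ x ] (a ≤ x × x ≤ b × maxFromTo f a b ≡ f x)
  maxFromTo-attained a≤b with foldr-selective ⊔-sel 0 (values f a b)
  ... | inj₂ max∈ = ∈-values⁻ a≤b max∈
  ... | inj₁ max≡0 = a , ≤-refl , a≤b , trans max≡0 (sym (n≤0⇒n≡0 (subst (f a ≤_) max≡0 (≤-maxFromTo ≤-refl a≤b))))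

module _ {n : ℕ} where

  IsClique-map : {G H : Graph n} (f : Fin n → Fin n) → (∀ {u v} → f u ≡ f v → u ≡ v) → (∀ {u v} → G u v → H (f u) (f v)) →
                 ∀ {xs} → IsClique G xs → IsClique H (map f xs)
  IsClique-map {G} {H} f f-injective f-hom {xs} (unique , adjacent) = map⁺ f-injective unique , adjacent′
    where
    adjacent′ : ∀ u v → u ∈ map f xs → v ∈ map f xs → ¬ u ≡ v → H u v
    adjacent′ u v u∈ v∈ u≢v with ∈-map⁻ f u∈ | ∈-map⁻ f v∈
    ... | u′ , u′∈ , refl | v′ , v′∈ , refl = f-hom (adjacent u′ v′ u′∈ v′∈ (u≢v ∘ cong f))

  CliqueNumber-≅ : {G H : Graph n} {m : ℕ} → G ≅ H → CliqueNumber H m → CliqueNumber G m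
  CliqueNumber-≅ {G} {H} {m} (π , π-iso) ((ys , ys-clique , ys-length) , maximal) =
    (map (π ⟨$⟩ˡ_) ys , IsClique-map (π ⟨$⟩ˡ_) from-injective from-hom ys-clique , trans (length-map _ ys) ys-length) ,
    λ xs xs-clique → subst (_≤ m) (length-map _ xs) (maximal _ (IsClique-map (π ⟨$⟩ʳ_) to-injective to-hom xs-clique))
    where
    to-injective : ∀ {u v} → π ⟨$⟩ʳ u ≡ π ⟨$⟩ʳ v → u ≡ v
    to-injective {u} {v} eq = trans (sym (inverseˡ π)) (trans (cong (π ⟨$⟩ˡ_) eq) (inverseˡ π))
    from-injective : ∀ {u v} → π ⟨$⟩ˡ u ≡ π ⟨$⟩ˡ v → u ≡ v
    from-injective {u} {v} eq = trans (sym (inverseʳ π)) (trans (cong (π ⟨$⟩ʳ_) eq) (inverseʳ π))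
    to-hom : ∀ {u v} → G u v → H (π ⟨$⟩ʳ u) (π ⟨$⟩ʳ v)
    to-hom {u} {v} = proj₁ (π-iso u v)
    from-hom : ∀ {u v} → H u v → G (π ⟨$⟩ˡ u) (π ⟨$⟩ˡ v)
    from-hom {u} {v} h = proj₂ (π-iso (π ⟨$⟩ˡ u) (π ⟨$⟩ˡ v)) (subst₂ H (sym (inverseʳ π)) (sym (inverseʳ π)) h)

-- The three candidates for a_i: B_{i,j}, B_{i,j+1}, and B^{*+}_{i,j} ∪ B^{+*}_{i,j+1}.
data Centre : Set where
  left right straddle : Centre

pattern below w = inj₁ w
pattern above w = inj₂ (inj₁ w)
pattern middle w = inj₂ (inj₂ w)

module BubbleGraph {n : ℕ} (B : BubbleStructure n) where
  open BubbleStructure B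

  RowsNonempty : Set
  RowsNonempty = ∀ {j} → 1 ≤ j → j ≤ k → 1 ≤ r j

  columns-clash : ∀ {v j} → col v ≡ j → ¬ col v ≡ suc j
  columns-clash col≡j col≡1+j = 1+n≢n (trans (sym col≡1+j) col≡j)

  row-≤-r : ∀ {v j} → col v ≡ j → row v ≤ r j
  row-≤-r {v} refl = proj₂ (row-range v)

  Below Above : ℕ → ℕ → Pred (Fin n) 0ℓ
  Below j i v = col v ≡ j × i < row v
  Above j i v = col v ≡ suc j × row v < i

  Middle : Centre → ℕ → ℕ → Pred (Fin n) 0ℓ
  Middle left j i v = row v ≡ i × col v ≡ j
  Middle right j i v = row v ≡ i × col v ≡ suc j
  Middle straddle j i v = (row v ≡ i × col v ≡ j × T (sgn₂ v)) ⊎ (row v ≡ i × col v ≡ suc j × T (sgn₁ v))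

  Window : Centre → ℕ → ℕ → Pred (Fin n) 0ℓ
  Window c j i = Below j i ∪ Above j i ∪ Middle c j i

  below? : ∀ j i → Decidable (Below j i)
  below? j i v = col v ≟ j ×-dec i <? row v

  above? : ∀ j i → Decidable (Above j i)
  above? j i v = col v ≟ suc j ×-dec row v <? i

  middle? : ∀ c j i → Decidable (Middle c j i)
  middle? left j i v = row v ≟ i ×-dec col v ≟ j
  middle? right j i v = row v ≟ i ×-dec col v ≟ suc j
  middle? straddle j i v = (row v ≟ i ×-dec col v ≟ j ×-dec T? (sgn₂ v)) ⊎-dec (row v ≟ i ×-dec col v ≟ suc j ×-dec T? (sgn₁ v))

  window? : ∀ c j i → Decidable (Window c j i)
  window? c j i = below? j i ∪? above? j i ∪? middle? c j i

  belowSize aboveSize : ℕ → ℕ → ℕ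
  belowSize j i = sumFromTo (λ i′ → ∣B∣ B i′ j) (suc i) (r j)
  aboveSize j i = sumFromTo (λ i′ → ∣B∣ B i′ (suc j)) 1 (i ∸ 1)

  centreSize : Centre → ℕ → ℕ → ℕ
  centreSize left j i = ∣B∣ B i j
  centreSize right j i = ∣B∣ B i (suc j)
  centreSize straddle j i = ∣B*+∣ B i j + ∣B+*∣ B i (suc j)

  -- The Boolean tests in the definition of ∣B∣ are definitionally the `does` of these decisions.
  ∣B∣-count : ∀ i j → ∣B∣ B i j ≡ count (λ v → row v ≟ i ×-dec col v ≟ j) (allFin n)
  ∣B∣-count i j = cong length (filterᵇ-does _ (allFin n))

  count-column-InRange : ∀ j a m → count (λ v → col v ≟ j ×-dec inRange? a m (row v)) (allFin n) ≡
                                    sum (map (λ t → ∣B∣ B (a + t) j) (upTo m))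
  count-column-InRange j a m =
    trans (count-InRange row (λ v → col v ≟ j) a m (allFin n)) (cong sum (map-cong (λ t → sym (∣B∣-count (a + t) j)) (upTo m)))

  count-below : ∀ j i → count (below? j i) (allFin n) ≡ belowSize j i
  count-below j i = trans (count-≐ _ _ (to , from) (allFin n)) (count-column-InRange j (suc i) (r j ∸ i))
    where
    to : ∀ {v} → Below j i v → col v ≡ j × InRange (suc i) (r j ∸ i) (row v)
    to (col≡j , i<row) = col≡j , i<row , s≤s (≤-trans (row-≤-r col≡j) (m≤n+m∸n (r j) i))
    from : ∀ {v} → col v ≡ j × InRange (suc i) (r j ∸ i) (row v) → Below j i v
    from (col≡j , i<row , _) = col≡j , i<row

  count-above : ∀ j i → count (above? j i) (allFin n) ≡ aboveSize j i
  count-above j i = trans (count-≐ _ _ (to , from) (allFin n)) (count-column-InRange (suc j) 1 (i ∸ 1))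
    where
    to : ∀ {v} → Above j i v → col v ≡ suc j × InRange 1 (i ∸ 1) (row v)
    to {v} (col≡ , row<i) = col≡ , proj₁ (row-range v) , ≤-trans row<i (m≤n+m∸n i 1)
    <-unpred : ∀ i {x} → 1 ≤ x → x < suc (i ∸ 1) → x < i
    <-unpred zero 1≤x x<1 = ⊥-elim (<⇒≱ x<1 1≤x)
    <-unpred (suc i) _ x<1+i = x<1+i
    from : ∀ {v} → col v ≡ suc j × InRange 1 (i ∸ 1) (row v) → Above j i v
    from (col≡ , 1≤row , row<) = col≡ , <-unpred i 1≤row row<

  count-middle : ∀ c j i → count (middle? c j i) (allFin n) ≡ centreSize c j i
  count-middle left j i = sym (∣B∣-count i j)
  count-middle right j i = sym (∣B∣-count i (suc j))
  count-middle straddle j i = begin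
    count (middle? straddle j i) (allFin n)
      ≡⟨ count-∪ _ _ (λ (_ , col≡j , _) (_ , col≡1+j , _) → columns-clash col≡j col≡1+j) (allFin n) ⟩
    count (λ v → row v ≟ i ×-dec col v ≟ j ×-dec T? (sgn₂ v)) (allFin n) +
    count (λ v → row v ≟ i ×-dec col v ≟ suc j ×-dec T? (sgn₁ v)) (allFin n)
      ≡⟨ sym (cong₂ _+_ (cong length (filterᵇ-does _ (allFin n))) (cong length (filterᵇ-does _ (allFin n)))) ⟩
    ∣B*+∣ B i j + ∣B+*∣ B i (suc j)
      ∎
    where open ≡-Reasoning

  Middle-row : ∀ c {j i v} → Middle c j i v → row v ≡ i
  Middle-row left (row≡ , _) = row≡
  Middle-row right (row≡ , _) = row≡
  Middle-row straddle (inj₁ (row≡ , _)) = row≡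
  Middle-row straddle (inj₂ (row≡ , _)) = row≡

  count-window : ∀ c j i → count (window? c j i) (allFin n) ≡ belowSize j i + aboveSize j i + centreSize c j i
  count-window c j i = begin
    count (window? c j i) (allFin n)
      ≡⟨ count-∪ _ _ below∉ (allFin n) ⟩
    count (below? j i) (allFin n) + count (above? j i ∪? middle? c j i) (allFin n)
      ≡⟨ cong (count (below? j i) (allFin n) +_) (count-∪ _ _ above∉ (allFin n)) ⟩
    count (below? j i) (allFin n) + (count (above? j i) (allFin n) + count (middle? c j i) (allFin n))
      ≡⟨ cong₂ _+_ (count-below j i) (cong₂ _+_ (count-above j i) (count-middle c j i)) ⟩
    belowSize j i + (aboveSize j i + centreSize c j i)
      ≡⟨ sym (+-assoc (belowSize j i) _ _) ⟩
    belowSize j i + aboveSize j i + centreSize c j i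
      ∎
    where
    open ≡-Reasoning
    below∉ : ∀ {v} → Below j i v → (Above j i ∪ Middle c j i) v → ⊥
    below∉ (col≡j , _) (inj₁ (col≡1+j , _)) = columns-clash col≡j col≡1+j
    below∉ (_ , i<row) (inj₂ m) = <-irrefl (sym (Middle-row c m)) i<row
    above∉ : ∀ {v} → Above j i v → Middle c j i v → ⊥
    above∉ (_ , row<i) m = <-irrefl (Middle-row c m) row<i

  aTerm-inside : ∀ {j i} → i ≤ r j → aTerm B j i ≡ (centreSize left j i ⊔ centreSize right j i) ⊔ centreSize straddle j i
  aTerm-inside i≤r rewrite Equivalence.to T-≡ (≤⇒≤ᵇ i≤r) = refl

  aTerm-outside : ∀ {j i} → ¬ i ≤ r j → aTerm B j i ≡ centreSize right j i
  aTerm-outside {j} {i} i≰r with i ≤ᵇ r j in i≤ᵇr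
  ... | true = ⊥-elim (i≰r (≤ᵇ⇒≤ i (r j) (Equivalence.from T-≡ i≤ᵇr)))
  ... | false = refl

  centreSize-≤-aTerm-inside : ∀ {j i} → i ≤ r j → ∀ c → centreSize c j i ≤ aTerm B j i
  centreSize-≤-aTerm-inside {j} {i} i≤r c rewrite aTerm-inside i≤r with c
  ... | left = ≤-trans (m≤m⊔n _ _) (m≤m⊔n _ _)
  ... | right = ≤-trans (m≤n⊔m (centreSize left j i) _) (m≤m⊔n _ _)
  ... | straddle = m≤n⊔m _ _

  centreSize-≤-aTerm : ∀ c {j i} → c ≡ right ⊎ i ≤ r j → centreSize c j i ≤ aTerm B j i
  centreSize-≤-aTerm c (inj₂ i≤r) = centreSize-≤-aTerm-inside i≤r c
  centreSize-≤-aTerm right {j} {i} (inj₁ refl) with i ≤? r j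
  ... | yes i≤r = centreSize-≤-aTerm-inside i≤r right
  ... | no i≰r = ≤-reflexive (sym (aTerm-outside i≰r))

  aTerm-attained : ∀ j i → ∃[ c ] aTerm B j i ≡ centreSize c j i
  aTerm-attained j i with i ≤? r j
  ... | no i≰r = right , aTerm-outside i≰r
  ... | yes i≤r with ⊔-sel (centreSize left j i ⊔ centreSize right j i) (centreSize straddle j i)
                   | ⊔-sel (centreSize left j i) (centreSize right j i)
  ...   | inj₂ ≡straddle | _ = straddle , trans (aTerm-inside i≤r) ≡straddle
  ...   | inj₁ ≡lr | inj₁ ≡left = left , trans (aTerm-inside i≤r) (trans ≡lr ≡left)
  ...   | inj₁ ≡lr | inj₂ ≡right = right , trans (aTerm-inside i≤r) (trans ≡lr ≡right)

  count-window-≤-term : ∀ c {j i} → c ≡ right ⊎ i ≤ r j → count (window? c j i) (allFin n) ≤ term B j i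
  count-window-≤-term c {j} {i} admissible =
    subst (_≤ term B j i) (sym (count-window c j i)) (+-monoʳ-≤ (belowSize j i + aboveSize j i) (centreSize-≤-aTerm c admissible))

  count-window-attains-term : ∀ j i → ∃[ c ] count (window? c j i) (allFin n) ≡ term B j i
  count-window-attains-term j i with aTerm-attained j i
  ... | c , aTerm≡ = c , trans (count-window c j i) (cong (belowSize j i + aboveSize j i +_) (sym aTerm≡))

  term-≤-omegaFormula : ∀ {j i} → 1 ≤ j → suc j ≤ k → 1 ≤ i → i ≤ r (suc j) → term B j i ≤ omegaFormula B
  term-≤-omegaFormula {j} 1≤j j<k 1≤i i≤r =
    ≤-trans (≤-maxFromTo (term B j) 1 (r (suc j)) 1≤i i≤r)
            (≤-maxFromTo (λ j → maxFromTo (term B j) 1 (r (suc j))) 1 (k ∸ 1) 1≤j (∸-monoˡ-≤ 1 j<k))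

  omegaFormula-attained : 2 ≤ k → RowsNonempty → ∃[ j ] ∃[ i ] omegaFormula B ≡ term B j i
  omegaFormula-attained 2≤k rows-nonempty with maxFromTo-attained (λ j → maxFromTo (term B j) 1 (r (suc j))) 1 (k ∸ 1) (∸-monoˡ-≤ 1 2≤k)
  ... | j , _ , j≤k-1 , outer≡ with maxFromTo-attained (term B j) 1 (r (suc j)) (rows-nonempty z<s j<k)
    where
    j<k : suc j ≤ k
    j<k = subst (suc j ≤_) (m+[n∸m]≡n (≤-trans z<s 2≤k)) (s≤s j≤k-1)
  ...   | i , _ , _ , inner≡ = j , i , trans outer≡ inner≡

  Window-col : ∀ {c j i v} → Window c j i v → col v ≡ j ⊎ col v ≡ suc j
  Window-col (below (col≡ , _)) = inj₁ col≡
  Window-col (above (col≡ , _)) = inj₂ col≡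
  Window-col {left} (middle (_ , col≡)) = inj₁ col≡
  Window-col {right} (middle (_ , col≡)) = inj₂ col≡
  Window-col {straddle} (middle (inj₁ (_ , col≡ , _))) = inj₁ col≡
  Window-col {straddle} (middle (inj₂ (_ , col≡ , _))) = inj₂ col≡

  module _ {j : ℕ} {u v : Fin n} (col-u : col u ≡ j) (col-v : col v ≡ suc j) where

    descending : row v < row u → BRel B u v
    descending v<u = inj₂ (inj₁ (trans (cong suc col-u) (sym col-v) , v<u))

    Middle-cross : ∀ c {i} → Middle c j i u → Middle c j i v → BRel B u v
    Middle-cross left _ (_ , col≡) = ⊥-elim (columns-clash col≡ col-v)
    Middle-cross right (_ , col≡) _ = ⊥-elim (columns-clash col-u col≡)
    Middle-cross straddle (inj₁ (row-u , _ , s₂)) (inj₂ (row-v , _ , s₁)) =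
      inj₂ (inj₂ (trans (cong suc col-u) (sym col-v) , trans row-u (sym row-v) , Equivalence.to T-≡ s₂ , Equivalence.to T-≡ s₁))
    Middle-cross straddle (inj₁ _) (inj₁ (_ , col≡ , _)) = ⊥-elim (columns-clash col≡ col-v)
    Middle-cross straddle (inj₂ (_ , col≡ , _)) _ = ⊥-elim (columns-clash col-u col≡)

    Window-cross : ∀ c {i} → Window c j i u → Window c j i v → BRel B u v
    Window-cross c (below (_ , i<u)) (above (_ , v<i)) = descending (<-trans v<i i<u)
    Window-cross c (below (_ , i<u)) (middle m) = descending (subst (_< row u) (sym (Middle-row c m)) i<u)
    Window-cross c (below _) (below (col≡ , _)) = ⊥-elim (columns-clash col≡ col-v)
    Window-cross c (above (col≡ , _)) _ = ⊥-elim (columns-clash col-u col≡)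
    Window-cross c (middle _) (below (col≡ , _)) = ⊥-elim (columns-clash col≡ col-v)
    Window-cross c (middle m) (above (_ , v<i)) = descending (subst (row v <_) (sym (Middle-row c m)) v<i)
    Window-cross c (middle mu) (middle mv) = Middle-cross c mu mv

  Window-adjacent : ∀ {c j i u v} → Window c j i u → Window c j i v → ¬ u ≡ v → GB B u v
  Window-adjacent {c} wu wv u≢v with Window-col wu | Window-col wv
  ... | inj₁ col-u | inj₁ col-v = u≢v , inj₁ (inj₁ (trans col-u (sym col-v)))
  ... | inj₁ col-u | inj₂ col-v = u≢v , inj₁ (Window-cross col-u col-v c wu wv)
  ... | inj₂ col-u | inj₁ col-v = u≢v , inj₂ (Window-cross col-v col-u c wv wu)
  ... | inj₂ col-u | inj₂ col-v = u≢v , inj₁ (inj₁ (trans col-u (sym col-v)))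

  IsClique-window : ∀ c j i → IsClique (GB B) (filter (window? c j i) (allFin n))
  IsClique-window c j i = filter⁺ (window? c j i) (allFin⁺ n) , λ u v u∈ v∈ → Window-adjacent (in-window u∈) (in-window v∈)
    where
    in-window : ∀ {v} → v ∈ filter (window? c j i) (allFin n) → Window c j i v
    in-window v∈ = proj₂ (∈-filter⁻ (window? c j i) {xs = allFin n} v∈)

  BRel-col : ∀ {u v} → BRel B u v → col u ≡ col v ⊎ suc (col u) ≡ col v
  BRel-col (inj₁ same) = inj₁ same
  BRel-col (inj₂ (inj₁ (step , _))) = inj₂ step
  BRel-col (inj₂ (inj₂ (step , _))) = inj₂ step

  GB-col-≤ : ∀ {u v} → GB B u v → col v ≤ suc (col u)
  GB-col-≤ (_ , inj₁ uv) with BRel-col uv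
  ... | inj₁ same = m≤n⇒m≤1+n (≤-reflexive (sym same))
  ... | inj₂ step = ≤-reflexive (sym step)
  GB-col-≤ (_ , inj₂ vu) with BRel-col vu
  ... | inj₁ same = m≤n⇒m≤1+n (≤-reflexive same)
  ... | inj₂ step = m≤n⇒m≤1+n (≤-trans (n≤1+n _) (≤-reflexive step))

  no-backstep : ∀ {j u v} → col u ≡ j → col v ≡ suc j → ¬ suc (col v) ≡ col u
  no-backstep col-u col-v step = 2+n≢n (trans (cong suc (sym col-v)) (trans step col-u))
    where
    2+n≢n : ∀ {m} → ¬ suc (suc m) ≡ m
    2+n≢n ()

  GB-cross : ∀ {j u v} → col u ≡ j → col v ≡ suc j → GB B u v →
             row v < row u ⊎ (row u ≡ row v × sgn₂ u ≡ true × sgn₁ v ≡ true)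
  GB-cross col-u col-v (_ , inj₁ (inj₁ same)) = ⊥-elim (columns-clash col-u (trans same col-v))
  GB-cross col-u col-v (_ , inj₁ (inj₂ (inj₁ (_ , v<u)))) = inj₁ v<u
  GB-cross col-u col-v (_ , inj₁ (inj₂ (inj₂ (_ , rows≡ , s₂ , s₁)))) = inj₂ (rows≡ , s₂ , s₁)
  GB-cross col-u col-v (_ , inj₂ (inj₁ same)) = ⊥-elim (columns-clash col-u (trans (sym same) col-v))
  GB-cross col-u col-v (_ , inj₂ (inj₂ (inj₁ (step , _)))) = ⊥-elim (no-backstep col-u col-v step)
  GB-cross col-u col-v (_ , inj₂ (inj₂ (inj₂ (step , _)))) = ⊥-elim (no-backstep col-u col-v step)

  distinct-columns : ∀ {j u v} → col u ≡ j → col v ≡ suc j → ¬ u ≡ v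
  distinct-columns col-u col-v refl = columns-clash col-u col-v

  clique-columns : ∀ {x xs} → IsClique (GB B) (x ∷ xs) →
                   ∃[ c ] (1 ≤ c × c ≤ k × (∀ {v} → v ∈ x ∷ xs → col v ≡ c ⊎ col v ≡ suc c))
  clique-columns {x} {xs} (_ , adjacent) = col y₀ , proj₁ (col-range y₀) , proj₂ (col-range y₀) ,
    λ v∈ → ≤∧≤1+⇒≡∨≡1+ (argmin-≤ col x xs v∈) (≤-1+col-y₀ v∈)
    where
    y₀ : Fin n
    y₀ = argmin col x xs
    ≤-1+col-y₀ : ∀ {v} → v ∈ x ∷ xs → col v ≤ suc (col y₀)
    ≤-1+col-y₀ {v} v∈ with v ≟ᶠ y₀
    ... | yes refl = n≤1+n (col v)
    ... | no v≢y₀ = GB-col-≤ (adjacent y₀ v (argmin-∈ col x xs) v∈ (v≢y₀ ∘ sym))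

  clique-in-adjacent-columns : 2 ≤ k → ∀ {xs} → IsClique (GB B) xs →
                               ∃[ j ] (1 ≤ j × suc j ≤ k × (∀ {v} → v ∈ xs → col v ≡ j ⊎ col v ≡ suc j))
  clique-in-adjacent-columns 2≤k {[]} _ = 1 , ≤-refl , 2≤k , λ ()
  clique-in-adjacent-columns 2≤k {x ∷ xs} clique with clique-columns clique
  ... | c , 1≤c , c≤k , near with suc c ≤? k
  ...   | yes c<k = c , 1≤c , c<k , near
  ...   | no c≮k = k ∸ 1 , ∸-monoˡ-≤ 1 2≤k , ≤-reflexive 1+[k∸1]≡k , λ v∈ → inj₂ (trans (col≡k v∈) (sym 1+[k∸1]≡k))
    where
    1+[k∸1]≡k : suc (k ∸ 1) ≡ k
    1+[k∸1]≡k = m+[n∸m]≡n (≤-trans z<s 2≤k)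
    col≡k : ∀ {v} → v ∈ x ∷ xs → col v ≡ k
    col≡k {v} v∈ with near v∈
    ... | inj₁ col≡c = trans col≡c (≤-antisym c≤k (≤-pred (≰⇒> c≮k)))
    ... | inj₂ col≡1+c = ⊥-elim (c≮k (subst (_≤ k) col≡1+c (proj₂ (col-range v))))

  module _ {j : ℕ} {xs : List (Fin n)} (clique : IsClique (GB B) xs)
           (columns : ∀ {v} → v ∈ xs → col v ≡ j ⊎ col v ≡ suc j) where

    window-left : (∀ {v} → v ∈ xs → ¬ col v ≡ suc j) → ∀ {v} → v ∈ xs → Window left j 1 v
    window-left none {v} v∈ with columns v∈ | row v ≟ 1
    ... | inj₂ col≡1+j | _ = ⊥-elim (none v∈ col≡1+j)
    ... | inj₁ col≡j | yes row≡1 = middle (row≡1 , col≡j)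
    ... | inj₁ col≡j | no row≢1 = below (col≡j , ≤∧≢⇒< (proj₁ (row-range v)) (row≢1 ∘ sym))

    module _ {t : Fin n} (t∈ : t ∈ xs) (col-t : col t ≡ suc j)
             (t-lowest : ∀ {v} → v ∈ xs → col v ≡ suc j → row v ≤ row t) where

      left-of-t : ∀ {v} → v ∈ xs → col v ≡ j → row t < row v ⊎ (row v ≡ row t × T (sgn₂ v))
      left-of-t v∈ col-v with GB-cross col-v col-t (proj₂ clique _ t v∈ t∈ (distinct-columns col-v col-t))
      ... | inj₁ t<v = inj₁ t<v
      ... | inj₂ (rows≡ , s₂ , _) = inj₂ (rows≡ , Equivalence.from T-≡ s₂)

      window-right : (∀ {u} → u ∈ xs → col u ≡ j → ¬ row u ≡ row t) → ∀ {v} → v ∈ xs → Window right j (row t) v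
      window-right none v∈ with columns v∈
      ... | inj₂ col-v =
        [ (λ v<t → above (col-v , v<t)) , (λ rows≡ → middle (rows≡ , col-v)) ] (m≤n⇒m<n∨m≡n (t-lowest v∈ col-v))
      ... | inj₁ col-v =
        [ (λ t<v → below (col-v , t<v)) , (λ (rows≡ , _) → ⊥-elim (none v∈ col-v rows≡)) ] (left-of-t v∈ col-v)

      window-straddle : ∀ {u} → u ∈ xs → col u ≡ j → row u ≡ row t → ∀ {v} → v ∈ xs → Window straddle j (row t) v
      window-straddle {u} u∈ col-u row-u {v} v∈ with columns v∈
      ... | inj₁ col-v =
        [ (λ t<v → below (col-v , t<v)) , (λ (rows≡ , s₂) → middle (inj₁ (rows≡ , col-v , s₂))) ] (left-of-t v∈ col-v)
      ... | inj₂ col-v with m≤n⇒m<n∨m≡n (t-lowest v∈ col-v)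
      ...   | inj₁ v<t = above (col-v , v<t)
      ...   | inj₂ rows≡ with GB-cross col-u col-v (proj₂ clique u v u∈ v∈ (distinct-columns col-u col-v))
      ...     | inj₁ v<u = ⊥-elim (<-irrefl (trans rows≡ (sym row-u)) v<u)
      ...     | inj₂ (_ , _ , s₁) = middle (inj₂ (rows≡ , col-v , Equivalence.from T-≡ s₁))

    clique-in-window : 1 ≤ r j → 1 ≤ r (suc j) →
      ∃[ c ] ∃[ i ] (1 ≤ i × i ≤ r (suc j) × (c ≡ right ⊎ i ≤ r j) × (∀ {v} → v ∈ xs → Window c j i v))
    clique-in-window 1≤rj 1≤r1+j with argmax-satisfying (λ v → col v ≟ suc j) row xs
    ... | inj₁ none = left , 1 , ≤-refl , 1≤r1+j , inj₂ 1≤rj , window-left none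
    ... | inj₂ (t , t∈ , col-t , t-lowest) with any? (λ u → col u ≟ j ×-dec row u ≟ row t) xs
    ...   | yes some = let (u , u∈ , col-u , row-u) = find some in
      straddle , row t , proj₁ (row-range t) , row-≤-r col-t , inj₂ (subst (_≤ r j) row-u (row-≤-r col-u)) ,
      window-straddle t∈ col-t t-lowest u∈ col-u row-u
    ...   | no none =
      right , row t , proj₁ (row-range t) , row-≤-r col-t , inj₁ refl ,
      window-right t∈ col-t t-lowest (λ u∈ col-u row-u → none (lose u∈ (col-u , row-u)))

  clique-≤-omegaFormula : 2 ≤ k → RowsNonempty → ∀ {xs} → IsClique (GB B) xs → length xs ≤ omegaFormula B
  clique-≤-omegaFormula 2≤k rows-nonempty {xs} clique with clique-in-adjacent-columns 2≤k clique
  ... | j , 1≤j , j<k , columns with clique-in-window clique columns (rows-nonempty 1≤j (<⇒≤ j<k)) (rows-nonempty z<s j<k)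
  ...   | c , i , 1≤i , i≤r , admissible , covered = begin
    length xs                         ≤⟨ length-≤-unique _≟ᶠ_ (proj₁ clique) (λ v∈ → ∈-filter⁺ (window? c j i) (∈-allFin _) (covered v∈)) ⟩
    count (window? c j i) (allFin n)  ≤⟨ count-window-≤-term c admissible ⟩
    term B j i                        ≤⟨ term-≤-omegaFormula 1≤j j<k 1≤i i≤r ⟩
    omegaFormula B                    ∎
    where open ≤-Reasoning

  CliqueNumber-GB : 2 ≤ k → RowsNonempty → CliqueNumber (GB B) (omegaFormula B)
  CliqueNumber-GB 2≤k rows-nonempty with omegaFormula-attained 2≤k rows-nonempty
  ... | j , i , ω≡term with count-window-attains-term j i
  ...   | c , count≡term =
    (filter (window? c j i) (allFin n) , IsClique-window c j i , trans count≡term (sym ω≡term)) ,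
    λ _ clique → clique-≤-omegaFormula 2≤k rows-nonempty clique

  IsUBubbleModel⇒RowsNonempty : IsUBubbleModel B → RowsNonempty
  IsUBubbleModel⇒RowsNonempty model {j} 1≤j j≤k with IsUBubbleModel.last-nonempty model j 1≤j j≤k
  ... | v , _ , row≡r = subst (1 ≤_) row≡r (proj₁ (row-range v))

lemma16 : (n : ℕ) (G : Graph n) (B : BubbleStructure n) →
          IsUBubbleModel B → G ≅ GB B →
          2 ≤ BubbleStructure.k B →
          CliqueNumber G (omegaFormula B)
lemma16 n G B model G≅GB 2≤k =
  CliqueNumber-≅ G≅GB (BubbleGraph.CliqueNumber-GB B 2≤k (BubbleGraph.IsUBubbleModel⇒RowsNonempty B model))
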